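{- Let $p$ be a prime and $\Gamma$ a congruence subgroup of $\mathrm{SL}_2(\mathbb{Z})$ of level a power of $p$. For $s\ge1$ let $V_s\subseteq\mathfrak{sl}_2(\mathbb{F}_p)$ be as defined in the context. If $p^s\ne2$ then $V_s\subseteq V_{s+1}$. If $p=2$ then $V_1\subseteq V_2+\langle I\rangle$.
   Context: For $s\ge1$ let $G_s$ be the image of $\Gamma$ in $\mathrm{SL}_2(\mathbb{Z}/p^s\mathbb{Z})$, and $K_{s+1}$ the kernel of the reduction map $G_{s+1}\to G_s$ modulo $p^s$. Let $\exp_{1,s}:\mathfrak{sl}_2(\mathbb{F}_p)\to\mathrm{SL}_2(\mathbb{Z}/p^{s+1}\mathbb{Z})$, $A\mapsto I+p^s\widetilde A$ with $\widetilde A$ any lift of $A$; it is an injective homomorphism from the additive group onto the kernel of reduction mod $p^s$. Define $V_s=\exp_{1,s}^{ -1}(K_{s+1})$, an $\mathbb{F}_p$-subspace of $\mathfrak{sl}_2(\mathbb{F}_p)$ (traceless $2\times2$ matrices over $\mathbb{F}_p$). $\langle I\rangle$ is the span of the identity matrix (traceless when $p=2$). -}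

module Defs where

open import Data.Integer using (ℤ; +_; _+_; _*_; _-_; -_)
open import Data.Integer.Divisibility using (_∣_)
open import Data.Nat using (ℕ; suc; _^_)
open import Data.Product using (Σ; _×_; ∃)
open import Relation.Binary.PropositionalEquality using (_≡_)

record M2 : Set where
  constructor mat
  field
    a b c d : ℤ
open M2 public

I : M2
I = mat (+ 1) (+ 0) (+ 0) (+ 1)

_·_ : M2 → M2 → M2
mat a₁ b₁ c₁ d₁ · mat a₂ b₂ c₂ d₂ =
  mat (a₁ * a₂ + b₁ * c₂) (a₁ * b₂ + b₁ * d₂)
      (c₁ * a₂ + d₁ * c₂) (c₁ * b₂ + d₁ * d₂)

infixl 6 _⊕_
infixl 7 _⊛_ _·_

_⊕_ : M2 → M2 → M2
mat a₁ b₁ c₁ d₁ ⊕ mat a₂ b₂ c₂ d₂ = mat (a₁ + a₂) (b₁ + b₂) (c₁ + c₂) (d₁ + d₂)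

_⊛_ : ℤ → M2 → M2
k ⊛ mat a₁ b₁ c₁ d₁ = mat (k * a₁) (k * b₁) (k * c₁) (k * d₁)

det : M2 → ℤ
det (mat a₁ b₁ c₁ d₁) = a₁ * d₁ - b₁ * c₁

tr : M2 → ℤ
tr (mat a₁ b₁ c₁ d₁) = a₁ + d₁

adj : M2 → M2
adj (mat a₁ b₁ c₁ d₁) = mat d₁ (- b₁) (- c₁) a₁

infix 4 _≡[mod_]_ _≋[mod_]_

_≡[mod_]_ : ℤ → ℕ → ℤ → Set
x ≡[mod n ] y = (+ n) ∣ (x - y)

_≋[mod_]_ : M2 → ℕ → M2 → Set
M ≋[mod n ] N =
  (a M ≡[mod n ] a N) × (b M ≡[mod n ] b N) ×
  (c M ≡[mod n ] c N) × (d M ≡[mod n ] d N)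

record IsSubgroupSL2 (Γ : M2 → Set) : Set where
  field
    inSL2 : ∀ γ → Γ γ → det γ ≡ + 1
    one   : Γ I
    mul   : ∀ x y → Γ x → Γ y → Γ (x · y)
    inv   : ∀ x → Γ x → Γ (adj x)

-- Γ is a congruence subgroup whose level is a power of p:
-- it contains the principal congruence subgroup Γ(p^k) for some k.
IsCongruenceSubgroupPPowerLevel : ℕ → (M2 → Set) → Set
IsCongruenceSubgroupPPowerLevel p Γ =
  IsSubgroupSL2 Γ ×
  ∃ λ k → ∀ γ → det γ ≡ + 1 → γ ≋[mod p ^ k ] I → Γ γ

-- Membership in G_s (image of Γ in SL₂(ℤ/p^s)), for an integer matrix
-- representing an element of SL₂(ℤ/p^s).
InG : (M2 → Set) → ℕ → ℕ → M2 → Set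
InG Γ p s M = Σ M2 λ γ → Γ γ × (γ ≋[mod p ^ s ] M)

-- Membership in K_{s+1} = ker (G_{s+1} → G_s), represented in ℤ/p^{s+1}.
InK : (M2 → Set) → ℕ → ℕ → M2 → Set
InK Γ p s M = InG Γ p (suc s) M × (M ≋[mod p ^ s ] I)

-- exp_{1,s}(A) = I + p^s Ã  (Ã an integer lift of A)
exp1 : ℕ → ℕ → M2 → M2
exp1 p s A = I ⊕ ((+ (p ^ s)) ⊛ A)

InSl2 : ℕ → M2 → Set
InSl2 p A = tr A ≡[mod p ] + 0

-- A (integer lift) represents an element of V_s = exp_{1,s}^{-1}(K_{s+1})
InV : (M2 → Set) → ℕ → ℕ → M2 → Set
InV Γ p s A = InSl2 p A × InK Γ p s (exp1 p s A)

-- Write γ ∈ Γ, which lifts exp₁,ₛ(A), as γ = I + pˢN with N ≡ A (mod p). By the binomial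
-- theorem γᵖ = I + pˢ⁺¹N + (p choose 2) p²ˢ N² + p³ˢR, and modulo pˢ⁺² the last two terms
-- vanish unless pˢ = 2 (for odd p because p divides (p choose 2)), so γᵖ ∈ Γ shows A ∈ Vₛ₊₁.
-- For p = 2, s = 1 the quadratic term survives: γ² ≡ I + 4(N + N²) (mod 8), so N + N² ∈ V₂,
-- and Cayley–Hamilton with tr N even gives N + N² ≡ A − det N · I (mod 2).
module Submission where

open import Defs
open import Data.Integer using (ℤ)
open import Data.Nat using (ℕ; suc; _^_; _≤_)
open import Data.Nat.Primality using (Prime)
open import Data.Product using (Σ; _×_)
open import Relation.Binary.PropositionalEquality using (_≡_; _≢_)

open import Data.Empty using (⊥-elim)
open import Data.Integer using (+_; _+_; _*_; _-_; -_)
import Data.Integer.Properties as ℤ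
open import Data.Integer.Divisibility.Signed using (_∣_; ∣ᵤ⇒∣; ∣⇒∣ᵤ; divides; ∣-refl; ∣m∣n⇒∣m+n; ∣m∣n⇒∣m-n; ∣m⇒∣-m; ∣m⇒∣m*n; *-monoˡ-∣)
open import Data.Integer.Tactic.RingSolver using (solve; solve-∀)
open import Data.List using (_∷_; [])
open import Data.Nat using (zero; z≤n; s≤s)
import Data.Nat as ℕ
open import Data.Nat.Combinatorics using (_C_; nC1≡n; nCk+nC[k+1]≡[n+1]C[k+1])
import Data.Nat.Divisibility as ℕ
import Data.Nat.Properties as ℕ
open import Data.Nat.Primality using (euclidsLemma; prime⇒nonTrivial; ¬prime[0])
open import Data.Nat.Tactic.RingSolver using () renaming (solve to solveℕ)
open import Data.Product using (_,_)
open import Data.Sum using (inj₁; inj₂)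
open import Relation.Binary.Bundles using (Setoid)
open import Relation.Binary.PropositionalEquality using (refl; sym; trans; cong; cong₂; subst; subst₂; module ≡-Reasoning)
import Relation.Binary.Reasoning.Setoid as SetoidReasoning
open import Relation.Nullary using (yes; no)

private
  variable
    m n : ℕ
    x y z u v k : ℤ
    M N P A : M2
    Γ : M2 → Set

≡-entrywise : a M ≡ a N → b M ≡ b N → c M ≡ c N → d M ≡ d N → M ≡ N
≡-entrywise {mat _ _ _ _} {mat _ _ _ _} refl refl refl refl = refl

⊕-assoc : ∀ M N P → M ⊕ N ⊕ P ≡ M ⊕ (N ⊕ P)
⊕-assoc (mat m₁ m₂ m₃ m₄) (mat n₁ n₂ n₃ n₄) (mat p₁ p₂ p₃ p₄) =
  ≡-entrywise (ℤ.+-assoc m₁ n₁ p₁) (ℤ.+-assoc m₂ n₂ p₂) (ℤ.+-assoc m₃ n₃ p₃) (ℤ.+-assoc m₄ n₄ p₄)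

⊛-distribˡ-⊕ : ∀ k M N → k ⊛ (M ⊕ N) ≡ k ⊛ M ⊕ k ⊛ N
⊛-distribˡ-⊕ k (mat m₁ m₂ m₃ m₄) (mat n₁ n₂ n₃ n₄) =
  ≡-entrywise (ℤ.*-distribˡ-+ k m₁ n₁) (ℤ.*-distribˡ-+ k m₂ n₂) (ℤ.*-distribˡ-+ k m₃ n₃) (ℤ.*-distribˡ-+ k m₄ n₄)

cayley-hamilton : ∀ N → N · N ⊕ det N ⊛ I ≡ tr N ⊛ N
cayley-hamilton (mat n₁ n₂ n₃ n₄) =
  ≡-entrywise (entry₁₁ n₁ n₂ n₃ n₄) (entry₁₂ n₁ n₂ n₃ n₄) (entry₂₁ n₁ n₂ n₃ n₄) (entry₂₂ n₁ n₂ n₃ n₄)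
  where
  entry₁₁ : ∀ n₁ n₂ n₃ n₄ → n₁ * n₁ + n₂ * n₃ + (n₁ * n₄ - n₂ * n₃) * + 1 ≡ (n₁ + n₄) * n₁
  entry₁₁ = solve-∀
  entry₁₂ : ∀ n₁ n₂ n₃ n₄ → n₁ * n₂ + n₂ * n₄ + (n₁ * n₄ - n₂ * n₃) * + 0 ≡ (n₁ + n₄) * n₂
  entry₁₂ = solve-∀
  entry₂₁ : ∀ n₁ n₂ n₃ n₄ → n₃ * n₁ + n₄ * n₃ + (n₁ * n₄ - n₂ * n₃) * + 0 ≡ (n₁ + n₄) * n₃
  entry₂₁ = solve-∀
  entry₂₂ : ∀ n₁ n₂ n₃ n₄ → n₃ * n₂ + n₄ * n₄ + (n₁ * n₄ - n₂ * n₃) * + 1 ≡ (n₁ + n₄) * n₄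
  entry₂₂ = solve-∀

tr-⊕-square : ∀ N → tr (N ⊕ N · N) ≡ tr N * (+ 1 + tr N) - + 2 * det N
tr-⊕-square (mat n₁ n₂ n₃ n₄) = trace n₁ n₂ n₃ n₄
  where
  trace : ∀ n₁ n₂ n₃ n₄ →
    n₁ + (n₁ * n₁ + n₂ * n₃) + (n₄ + (n₃ * n₂ + n₄ * n₄))
      ≡ (n₁ + n₄) * (+ 1 + (n₁ + n₄)) - + 2 * (n₁ * n₄ - n₂ * n₃)
  trace = solve-∀

infixl 8 _^ᴹ_

_^ᴹ_ : M2 → ℕ → M2
g ^ᴹ zero  = I
g ^ᴹ suc n = g ^ᴹ n · g

^ᴹ-closed : IsSubgroupSL2 Γ → ∀ {g} → Γ g → ∀ n → Γ (g ^ᴹ n)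
^ᴹ-closed Γ-sub g∈Γ zero    = IsSubgroupSL2.one Γ-sub
^ᴹ-closed Γ-sub g∈Γ (suc n) = IsSubgroupSL2.mul Γ-sub _ _ (^ᴹ-closed Γ-sub g∈Γ n) g∈Γ

binomial-step : ∀ x u t N R →
  (I ⊕ (u * x) ⊛ N ⊕ (t * (x * x)) ⊛ (N · N) ⊕ (x * x * x) ⊛ R) · (I ⊕ x ⊛ N)
    ≡ I ⊕ ((+ 1 + u) * x) ⊛ N ⊕ ((t + u) * (x * x)) ⊛ (N · N)
        ⊕ (x * x * x) ⊛ (R ⊕ t ⊛ (N · N · N) ⊕ x ⊛ (R · N))
binomial-step x u t (mat n₁ n₂ n₃ n₄) (mat r₁ r₂ r₃ r₄) =
  ≡-entrywise (entry₁₁ x u t n₁ n₂ n₃ n₄ r₁ r₂) (entry₁₂ x u t n₁ n₂ n₃ n₄ r₁ r₂)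
              (entry₂₁ x u t n₁ n₂ n₃ n₄ r₃ r₄) (entry₂₂ x u t n₁ n₂ n₃ n₄ r₃ r₄)
  where
  entry₁₁ : ∀ x u t n₁ n₂ n₃ n₄ r₁ r₂ →
    (+ 1 + u * x * n₁ + t * (x * x) * (n₁ * n₁ + n₂ * n₃) + x * x * x * r₁) * (+ 1 + x * n₁)
      + (+ 0 + u * x * n₂ + t * (x * x) * (n₁ * n₂ + n₂ * n₄) + x * x * x * r₂) * (+ 0 + x * n₃)
    ≡ + 1 + (+ 1 + u) * x * n₁ + (t + u) * (x * x) * (n₁ * n₁ + n₂ * n₃)
      + x * x * x * (r₁ + t * ((n₁ * n₁ + n₂ * n₃) * n₁ + (n₁ * n₂ + n₂ * n₄) * n₃) + x * (r₁ * n₁ + r₂ * n₃))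
  entry₁₁ = solve-∀
  entry₁₂ : ∀ x u t n₁ n₂ n₃ n₄ r₁ r₂ →
    (+ 1 + u * x * n₁ + t * (x * x) * (n₁ * n₁ + n₂ * n₃) + x * x * x * r₁) * (+ 0 + x * n₂)
      + (+ 0 + u * x * n₂ + t * (x * x) * (n₁ * n₂ + n₂ * n₄) + x * x * x * r₂) * (+ 1 + x * n₄)
    ≡ + 0 + (+ 1 + u) * x * n₂ + (t + u) * (x * x) * (n₁ * n₂ + n₂ * n₄)
      + x * x * x * (r₂ + t * ((n₁ * n₁ + n₂ * n₃) * n₂ + (n₁ * n₂ + n₂ * n₄) * n₄) + x * (r₁ * n₂ + r₂ * n₄))
  entry₁₂ = solve-∀
  entry₂₁ : ∀ x u t n₁ n₂ n₃ n₄ r₃ r₄ →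
    (+ 0 + u * x * n₃ + t * (x * x) * (n₃ * n₁ + n₄ * n₃) + x * x * x * r₃) * (+ 1 + x * n₁)
      + (+ 1 + u * x * n₄ + t * (x * x) * (n₃ * n₂ + n₄ * n₄) + x * x * x * r₄) * (+ 0 + x * n₃)
    ≡ + 0 + (+ 1 + u) * x * n₃ + (t + u) * (x * x) * (n₃ * n₁ + n₄ * n₃)
      + x * x * x * (r₃ + t * ((n₃ * n₁ + n₄ * n₃) * n₁ + (n₃ * n₂ + n₄ * n₄) * n₃) + x * (r₃ * n₁ + r₄ * n₃))
  entry₂₁ = solve-∀
  entry₂₂ : ∀ x u t n₁ n₂ n₃ n₄ r₃ r₄ →
    (+ 0 + u * x * n₃ + t * (x * x) * (n₃ * n₁ + n₄ * n₃) + x * x * x * r₃) * (+ 0 + x * n₂)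
      + (+ 1 + u * x * n₄ + t * (x * x) * (n₃ * n₂ + n₄ * n₄) + x * x * x * r₄) * (+ 1 + x * n₄)
    ≡ + 1 + (+ 1 + u) * x * n₄ + (t + u) * (x * x) * (n₃ * n₂ + n₄ * n₄)
      + x * x * x * (r₄ + t * ((n₃ * n₁ + n₄ * n₃) * n₂ + (n₃ * n₂ + n₄ * n₄) * n₄) + x * (r₃ * n₂ + r₄ * n₄))
  entry₂₂ = solve-∀

[1+n]C2≡n+nC2 : ∀ n → suc n C 2 ≡ n ℕ.+ n C 2
[1+n]C2≡n+nC2 n = begin
  suc n C 2        ≡⟨ nCk+nC[k+1]≡[n+1]C[k+1] n 1 ⟨
  n C 1 ℕ.+ n C 2  ≡⟨ cong (ℕ._+ n C 2) (nC1≡n n) ⟩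
  n ℕ.+ n C 2      ∎
  where open ≡-Reasoning

binomial : ∀ x N n → Σ M2 λ R →
  (I ⊕ x ⊛ N) ^ᴹ n ≡ I ⊕ (+ n * x) ⊛ N ⊕ (+ (n C 2) * (x * x)) ⊛ (N · N) ⊕ (x * x * x) ⊛ R
binomial x (mat n₁ n₂ n₃ n₄) zero =
  mat (+ 0) (+ 0) (+ 0) (+ 0) ,
  ≡-entrywise (vanishing (+ 1) n₁ (n₁ * n₁ + n₂ * n₃)) (vanishing (+ 0) n₂ (n₁ * n₂ + n₂ * n₄))
              (vanishing (+ 0) n₃ (n₃ * n₁ + n₄ * n₃)) (vanishing (+ 1) n₄ (n₃ * n₂ + n₄ * n₄))
  where
  vanishing : ∀ δ n q → δ ≡ δ + + 0 * x * n + + 0 * (x * x) * q + x * x * x * + 0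
  vanishing δ n q = solve (δ ∷ x ∷ n ∷ q ∷ [])
binomial x N (suc n) with binomial x N n
... | R , expansion = R′ , (begin
  (I ⊕ x ⊛ N) ^ᴹ n · (I ⊕ x ⊛ N)
    ≡⟨ cong (_· (I ⊕ x ⊛ N)) expansion ⟩
  (I ⊕ (+ n * x) ⊛ N ⊕ (+ (n C 2) * (x * x)) ⊛ (N · N) ⊕ (x * x * x) ⊛ R) · (I ⊕ x ⊛ N)
    ≡⟨ binomial-step x (+ n) (+ (n C 2)) N R ⟩
  I ⊕ (+ suc n * x) ⊛ N ⊕ ((+ (n C 2) + + n) * (x * x)) ⊛ (N · N) ⊕ (x * x * x) ⊛ R′
    ≡⟨ cong (λ t → I ⊕ (+ suc n * x) ⊛ N ⊕ (t * (x * x)) ⊛ (N · N) ⊕ (x * x * x) ⊛ R′)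
            (cong +_ (trans (ℕ.+-comm (n C 2) n) (sym ([1+n]C2≡n+nC2 n)))) ⟩
  I ⊕ (+ suc n * x) ⊛ N ⊕ (+ (suc n C 2) * (x * x)) ⊛ (N · N) ⊕ (x * x * x) ⊛ R′ ∎)
  where
  open ≡-Reasoning
  R′ = R ⊕ + (n C 2) ⊛ (N · N · N) ⊕ x ⊛ (R · N)

2*[1+n]C2≡[1+n]*n : ∀ n → 2 ℕ.* (suc n C 2) ≡ suc n ℕ.* n
2*[1+n]C2≡[1+n]*n zero    = refl
2*[1+n]C2≡[1+n]*n (suc n) = begin
  2 ℕ.* (suc (suc n) C 2)               ≡⟨ cong (2 ℕ.*_) ([1+n]C2≡n+nC2 (suc n)) ⟩
  2 ℕ.* (suc n ℕ.+ suc n C 2)           ≡⟨ ℕ.*-distribˡ-+ 2 (suc n) (suc n C 2) ⟩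
  2 ℕ.* suc n ℕ.+ 2 ℕ.* (suc n C 2)     ≡⟨ cong (2 ℕ.* suc n ℕ.+_) (2*[1+n]C2≡[1+n]*n n) ⟩
  2 ℕ.* suc n ℕ.+ suc n ℕ.* n           ≡⟨ solveℕ (n ∷ []) ⟩
  suc (suc n) ℕ.* suc n                 ∎
  where open ≡-Reasoning

p≢2⇒p∣pC2 : ∀ {p} → Prime p → p ≢ 2 → p ℕ.∣ p C 2
p≢2⇒p∣pC2 {zero}  p-prime = ⊥-elim (¬prime[0] p-prime)
p≢2⇒p∣pC2 {suc q} p-prime p≢2 with euclidsLemma 2 (suc q C 2) p-prime p∣2*pC2
  where
  p∣2*pC2 : suc q ℕ.∣ 2 ℕ.* (suc q C 2)
  p∣2*pC2 = subst (suc q ℕ.∣_) (sym (2*[1+n]C2≡[1+n]*n q)) (ℕ.m∣m*n q)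
... | inj₂ p∣pC2 = p∣pC2
... | inj₁ p∣2   = ⊥-elim (p≢2 (ℕ.≤-antisym (ℕ.∣⇒≤ p∣2) 2≤p))
  where
  2≤p : 2 ≤ suc q
  2≤p = ℕ.nonTrivial⇒n>1 (suc q) {{prime⇒nonTrivial p-prime}}

p^[2+s]∣p^[2s] : ∀ p s → 2 ≤ s → p ^ (2 ℕ.+ s) ℕ.∣ p ^ s ℕ.* p ^ s
p^[2+s]∣p^[2s] p s@(suc (suc t)) _ =
  subst (ℕ._∣ p ^ s ℕ.* p ^ s) (ℕ.*-assoc p p (p ^ s))
    (ℕ.*-monoˡ-∣ (p ^ s) (ℕ.*-monoʳ-∣ p (ℕ.m∣m*n {p} (p ^ t))))
p^[2+s]∣p^[2s] p (suc zero) (s≤s ())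

p^[2+s]∣p^[3s] : ∀ p s → 1 ≤ s → p ^ (2 ℕ.+ s) ℕ.∣ p ^ s ℕ.* p ^ s ℕ.* p ^ s
p^[2+s]∣p^[3s] p s@(suc t) _ =
  subst (ℕ._∣ p ^ s ℕ.* p ^ s ℕ.* p ^ s) (ℕ.*-assoc p p (p ^ s))
    (ℕ.*-monoˡ-∣ (p ^ s) (ℕ.*-pres-∣ (ℕ.m∣m*n {p} (p ^ t)) (ℕ.m∣m*n {p} (p ^ t))))

-- For odd p the factor p comes from p C 2; for p = 2 it comes from s ≥ 2, which is where p ^ s ≢ 2 is needed.
p^[2+s]∣pC2*p^[2s] : ∀ {p s} → Prime p → 1 ≤ s → p ^ s ≢ 2 → p ^ (2 ℕ.+ s) ℕ.∣ (p C 2) ℕ.* (p ^ s ℕ.* p ^ s)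
p^[2+s]∣pC2*p^[2s] {p} {s} p-prime 1≤s p^s≢2 with p ℕ.≟ 2
... | no p≢2 = ℕ.*-pres-∣ (p≢2⇒p∣pC2 p-prime p≢2) (ℕ.*-monoˡ-∣ (p ^ s) (p∣p^s s 1≤s))
  where
  p∣p^s : ∀ s → 1 ≤ s → p ℕ.∣ p ^ s
  p∣p^s (suc t) _ = ℕ.m∣m*n {p} (p ^ t)
... | yes refl = subst (2 ^ (2 ℕ.+ s) ℕ.∣_) (sym (ℕ.*-identityˡ _)) (p^[2+s]∣p^[2s] 2 s (2≤s s 1≤s p^s≢2))
  where
  2≤s : ∀ s → 1 ≤ s → 2 ^ s ≢ 2 → 2 ≤ s
  2≤s (suc zero)    _ 2≢2 = ⊥-elim (2≢2 refl)
  2≤s (suc (suc _)) _ _   = s≤s (s≤s z≤n)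

≡[mod]⇒∣ : ∀ x y → x ≡[mod n ] y → + n ∣ x - y
≡[mod]⇒∣ {n = n} x y = ∣ᵤ⇒∣ {+ n} {x - y}

∣⇒≡[mod] : ∀ x y → + n ∣ x - y → x ≡[mod n ] y
∣⇒≡[mod] x y = ∣⇒∣ᵤ

≡[mod]-refl : ∀ x → x ≡[mod n ] x
≡[mod]-refl {n = n} x = ∣⇒≡[mod] x x (subst (+ n ∣_) (sym (ℤ.+-inverseʳ x)) (divides (+ 0) refl))

≡[mod]-sym : x ≡[mod n ] y → y ≡[mod n ] x
≡[mod]-sym {x = x} {n = n} {y = y} x≡y = ∣⇒≡[mod] y x (subst (+ n ∣_) negation (∣m⇒∣-m (≡[mod]⇒∣ x y x≡y)))
  where
  negation : - (x - y) ≡ y - x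
  negation = solve (x ∷ y ∷ [])

≡[mod]-trans : x ≡[mod n ] y → y ≡[mod n ] z → x ≡[mod n ] z
≡[mod]-trans {x = x} {n = n} {y = y} {z = z} x≡y y≡z =
  ∣⇒≡[mod] x z (subst (+ n ∣_) telescope (∣m∣n⇒∣m+n (≡[mod]⇒∣ x y x≡y) (≡[mod]⇒∣ y z y≡z)))
  where
  telescope : (x - y) + (y - z) ≡ x - z
  telescope = solve (x ∷ y ∷ z ∷ [])

≡[mod]-+ : x ≡[mod n ] y → u ≡[mod n ] v → x + u ≡[mod n ] y + v
≡[mod]-+ {x = x} {n = n} {y = y} {u = u} {v = v} x≡y u≡v =
  ∣⇒≡[mod] (x + u) (y + v) (subst (+ n ∣_) interchange (∣m∣n⇒∣m+n (≡[mod]⇒∣ x y x≡y) (≡[mod]⇒∣ u v u≡v)))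
  where
  interchange : (x - y) + (u - v) ≡ (x + u) - (y + v)
  interchange = solve (x ∷ y ∷ u ∷ v ∷ [])

≡[mod]-+-multiple : + n ∣ k → x + k * z ≡[mod n ] x
≡[mod]-+-multiple {n = n} {k = k} {x = x} {z = z} n∣k =
  ∣⇒≡[mod] (x + k * z) x (subst (+ n ∣_) cancellation (∣m⇒∣m*n z n∣k))
  where
  cancellation : k * z ≡ (x + k * z) - x
  cancellation = solve (k ∷ x ∷ z ∷ [])

≡[mod]-*ˡ : ∀ m → x ≡[mod n ] y → + m * x ≡[mod n ℕ.* m ] + m * y
≡[mod]-*ˡ {x = x} {n = n} {y = y} m x≡y =
  ∣⇒≡[mod] (+ m * x) (+ m * y) (subst₂ _∣_ (sym (ℤ.pos-* n m)) (distrib x y (+ m)) (*-monoˡ-∣ (+ m) (≡[mod]⇒∣ x y x≡y)))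
  where
  distrib : ∀ x y k → (x - y) * k ≡ k * x - k * y
  distrib = solve-∀

≡[mod]-split : ∀ m n {x δ e} → x ≡[mod m ℕ.* n ] δ + + n * e →
               Σ ℤ λ f → x ≡ δ + + n * f × f ≡[mod m ] e
≡[mod]-split m n {x} {δ} {e} x≡δ+ne with ≡[mod]⇒∣ x (δ + + n * e) x≡δ+ne
... | divides q x-δ-ne≡q*mn = e + q * + m , x≡δ+nf , ∣⇒≡[mod] (e + q * + m) e (divides q (f-e≡q*m e q (+ m)))
  where
  f-e≡q*m : ∀ e q m → (e + q * m) - e ≡ q * m
  f-e≡q*m = solve-∀
  minus-plus : ∀ x w → (x - w) + w ≡ x
  minus-plus = solve-∀
  regroup : ∀ δ e q m n → q * (m * n) + (δ + n * e) ≡ δ + n * (e + q * m)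
  regroup = solve-∀
  x≡δ+nf : x ≡ δ + + n * (e + q * + m)
  x≡δ+nf = begin
    x                              ≡⟨ sym (minus-plus x w) ⟩
    (x - w) + w                    ≡⟨ cong (_+ w) x-δ-ne≡q*mn ⟩
    q * + (m ℕ.* n) + w            ≡⟨ cong (λ t → q * t + w) (ℤ.pos-* m n) ⟩
    q * (+ m * + n) + w            ≡⟨ regroup δ e q (+ m) (+ n) ⟩
    δ + + n * (e + q * + m)        ∎
    where
    open ≡-Reasoning
    w = δ + + n * e

≡[mod]0⇒∣ : x ≡[mod n ] + 0 → + n ∣ x
≡[mod]0⇒∣ {x = x} {n = n} x≡0 = subst (+ n ∣_) (ℤ.+-identityʳ x) (≡[mod]⇒∣ x (+ 0) x≡0)

∣⇒≡[mod]0 : + n ∣ x → x ≡[mod n ] + 0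
∣⇒≡[mod]0 {n = n} {x = x} n∣x = ∣⇒≡[mod] x (+ 0) (subst (+ n ∣_) (sym (ℤ.+-identityʳ x)) n∣x)

ℕ∣⇒ℤ∣ : m ℕ.∣ n → + m ∣ + n
ℕ∣⇒ℤ∣ {m = m} {n = n} = ∣ᵤ⇒∣ {+ m} {+ n}

≋[mod]-refl : ∀ M → M ≋[mod n ] M
≋[mod]-refl (mat m₁ m₂ m₃ m₄) =
  ≡[mod]-refl m₁ , ≡[mod]-refl m₂ , ≡[mod]-refl m₃ , ≡[mod]-refl m₄

≋[mod]-sym : M ≋[mod n ] N → N ≋[mod n ] M
≋[mod]-sym {M = mat m₁ m₂ m₃ m₄} {N = mat n₁ n₂ n₃ n₄} (a≡ , b≡ , c≡ , d≡) =
  ≡[mod]-sym {x = m₁} a≡ , ≡[mod]-sym {x = m₂} b≡ , ≡[mod]-sym {x = m₃} c≡ , ≡[mod]-sym {x = m₄} d≡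

≋[mod]-trans : M ≋[mod n ] N → N ≋[mod n ] P → M ≋[mod n ] P
≋[mod]-trans {M = mat m₁ m₂ m₃ m₄} {N = mat n₁ n₂ n₃ n₄} (a≡ , b≡ , c≡ , d≡) (a≡′ , b≡′ , c≡′ , d≡′) =
  ≡[mod]-trans {x = m₁} {y = n₁} a≡ a≡′ , ≡[mod]-trans {x = m₂} {y = n₂} b≡ b≡′ ,
  ≡[mod]-trans {x = m₃} {y = n₃} c≡ c≡′ , ≡[mod]-trans {x = m₄} {y = n₄} d≡ d≡′

≋[mod]-setoid : ℕ → Setoid _ _
≋[mod]-setoid n = record
  { Carrier       = M2
  ; _≈_           = _≋[mod n ]_
  ; isEquivalence = record
    { refl  = λ {M} → ≋[mod]-refl M
    ; sym   = λ {M} {N} → ≋[mod]-sym {M = M} {N = N}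
    ; trans = λ {M} {N} {P} → ≋[mod]-trans {M = M} {N = N} {P = P}
    }
  }

≋[mod]-⊕-multiple : ∀ M N → + n ∣ k → M ⊕ k ⊛ N ≋[mod n ] M
≋[mod]-⊕-multiple (mat m₁ m₂ m₃ m₄) (mat n₁ n₂ n₃ n₄) n∣k =
  ≡[mod]-+-multiple {x = m₁} {z = n₁} n∣k , ≡[mod]-+-multiple {x = m₂} {z = n₂} n∣k ,
  ≡[mod]-+-multiple {x = m₃} {z = n₃} n∣k , ≡[mod]-+-multiple {x = m₄} {z = n₄} n∣k

exp1-cong : ∀ p s N A → N ≋[mod p ] A → exp1 p s N ≋[mod p ^ suc s ] exp1 p s A
exp1-cong p s (mat n₁ n₂ n₃ n₄) (mat a₁ a₂ a₃ a₄) (a≡ , b≡ , c≡ , d≡) =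
  entry (+ 1) a≡ , entry (+ 0) b≡ , entry (+ 0) c≡ , entry (+ 1) d≡
  where
  entry : ∀ δ {x y} → x ≡[mod p ] y → δ + + (p ^ s) * x ≡[mod p ^ suc s ] δ + + (p ^ s) * y
  entry δ {x} x≡y = ≡[mod]-+ {x = δ} {u = + (p ^ s) * x} (≡[mod]-refl δ) (≡[mod]-*ˡ {x = x} (p ^ s) x≡y)

≋[mod]⇒tr-≡[mod] : M ≋[mod n ] N → tr M ≡[mod n ] tr N
≋[mod]⇒tr-≡[mod] {M = mat m₁ _ _ m₄} (a≡ , _ , _ , d≡) = ≡[mod]-+ {x = m₁} {u = m₄} a≡ d≡

≋[mod]-split : ∀ m n → M ≋[mod m ℕ.* n ] I ⊕ + n ⊛ A → Σ M2 λ N → M ≡ I ⊕ + n ⊛ N × N ≋[mod m ] A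
≋[mod]-split m n (a≡ , b≡ , c≡ , d≡)
  with ≡[mod]-split m n {δ = + 1} a≡ | ≡[mod]-split m n {δ = + 0} b≡
     | ≡[mod]-split m n {δ = + 0} c≡ | ≡[mod]-split m n {δ = + 1} d≡
... | f₁ , a≡′ , f₁≡ | f₂ , b≡′ , f₂≡ | f₃ , c≡′ , f₃≡ | f₄ , d≡′ , f₄≡ =
  mat f₁ f₂ f₃ f₄ , ≡-entrywise a≡′ b≡′ c≡′ d≡′ , (f₁≡ , f₂≡ , f₃≡ , f₄≡)

exp1-≋[mod]-I : ∀ p s B → exp1 p s B ≋[mod p ^ s ] I
exp1-≋[mod]-I p s B = ≋[mod]-⊕-multiple I B ∣-refl

exp1[s]^p≋exp1[1+s] : ∀ {p s N A} → Prime p → 1 ≤ s → p ^ s ≢ 2 → N ≋[mod p ] A →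
  (I ⊕ + (p ^ s) ⊛ N) ^ᴹ p ≋[mod p ^ (2 ℕ.+ s) ] exp1 p (suc s) A
exp1[s]^p≋exp1[1+s] {p} {s} {N} {A} p-prime 1≤s p^s≢2 N≋A with binomial (+ (p ^ s)) N p
... | R , expansion = begin
  (I ⊕ pˢ ⊛ N) ^ᴹ p                            ≡⟨ expansion ⟩
  quadratic ⊕ (pˢ * pˢ * pˢ) ⊛ R                ≈⟨ ≋[mod]-⊕-multiple quadratic R cube-divisible ⟩
  quadratic                                     ≈⟨ ≋[mod]-⊕-multiple linear (N · N) square-divisible ⟩
  linear                                        ≡⟨ cong (λ k → I ⊕ k ⊛ N) (ℤ.pos-* p (p ^ s)) ⟨
  exp1 p (suc s) N                              ≈⟨ exp1-cong p (suc s) N A N≋A ⟩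
  exp1 p (suc s) A                              ∎
  where
  open SetoidReasoning (≋[mod]-setoid (p ^ (2 ℕ.+ s)))
  pˢ = + (p ^ s)
  linear    = I ⊕ (+ p * pˢ) ⊛ N
  quadratic = linear ⊕ (+ (p C 2) * (pˢ * pˢ)) ⊛ (N · N)
  square-divisible : + (p ^ (2 ℕ.+ s)) ∣ + (p C 2) * (pˢ * pˢ)
  square-divisible = subst (+ (p ^ (2 ℕ.+ s)) ∣_) (trans (ℤ.pos-* (p C 2) _) (cong (+ (p C 2) *_) (ℤ.pos-* (p ^ s) (p ^ s))))
    (ℕ∣⇒ℤ∣ (p^[2+s]∣pC2*p^[2s] p-prime 1≤s p^s≢2))
  cube-divisible : + (p ^ (2 ℕ.+ s)) ∣ pˢ * pˢ * pˢ
  cube-divisible = subst (+ (p ^ (2 ℕ.+ s)) ∣_) (trans (ℤ.pos-* (p ^ s ℕ.* p ^ s) (p ^ s)) (cong (_* pˢ) (ℤ.pos-* (p ^ s) (p ^ s))))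
    (ℕ∣⇒ℤ∣ (p^[2+s]∣p^[3s] p s 1≤s))

V[s]⊆V[1+s] : ∀ {p s A} → Prime p → IsSubgroupSL2 Γ → 1 ≤ s → p ^ s ≢ 2 → InV Γ p s A → InV Γ p (suc s) A
V[s]⊆V[1+s] {p = p} {s} {A} p-prime Γ-sub 1≤s p^s≢2 (trA , (γ , γ∈Γ , γ≋) , _)
  with ≋[mod]-split {M = γ} {A = A} p (p ^ s) γ≋
... | N , refl , N≋A =
  trA , (_ , ^ᴹ-closed Γ-sub γ∈Γ p , exp1[s]^p≋exp1[1+s] p-prime 1≤s p^s≢2 N≋A) , exp1-≋[mod]-I p (suc s) A

-- The coefficients are rewritten through scalar equations: converting the matrix expressions
-- directly would make Agda unfold the integer products inside (I + 2N)².
[I⊕2N]^2≋exp1[2] : ∀ N → (I ⊕ + 2 ⊛ N) ^ᴹ 2 ≋[mod 2 ^ suc 2 ] exp1 2 2 (N ⊕ N · N)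
[I⊕2N]^2≋exp1[2] N = let (R , expansion) = binomial (+ 2) N 2 in begin
  (I ⊕ + 2 ⊛ N) ^ᴹ 2
    ≡⟨ expansion ⟩
  I ⊕ (+ 2 * + 2) ⊛ N ⊕ (+ (2 C 2) * (+ 2 * + 2)) ⊛ (N · N) ⊕ (+ 2 * + 2 * + 2) ⊛ R
    ≈⟨ ≋[mod]-⊕-multiple (I ⊕ (+ 2 * + 2) ⊛ N ⊕ (+ (2 C 2) * (+ 2 * + 2)) ⊛ (N · N)) R ∣-refl ⟩
  I ⊕ (+ 2 * + 2) ⊛ N ⊕ (+ (2 C 2) * (+ 2 * + 2)) ⊛ (N · N)
    ≡⟨ ⊕-assoc I ((+ 2 * + 2) ⊛ N) ((+ (2 C 2) * (+ 2 * + 2)) ⊛ (N · N)) ⟩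
  I ⊕ ((+ 2 * + 2) ⊛ N ⊕ (+ (2 C 2) * (+ 2 * + 2)) ⊛ (N · N))
    ≡⟨ cong (I ⊕_) (cong₂ (λ k l → k ⊛ N ⊕ l ⊛ (N · N)) linear-coefficient quadratic-coefficient) ⟩
  I ⊕ (+ (2 ^ 2) ⊛ N ⊕ + (2 ^ 2) ⊛ (N · N))
    ≡⟨ cong (I ⊕_) (⊛-distribˡ-⊕ (+ (2 ^ 2)) N (N · N)) ⟨
  exp1 2 2 (N ⊕ N · N)
    ∎
  where
  open SetoidReasoning (≋[mod]-setoid (2 ^ suc 2))
  linear-coefficient : + 2 * + 2 ≡ + (2 ^ 2)
  linear-coefficient = refl
  quadratic-coefficient : + (2 C 2) * (+ 2 * + 2) ≡ + (2 ^ 2)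
  quadratic-coefficient = refl

V₁⊆V₂+⟨I⟩ : IsSubgroupSL2 Γ → InV Γ 2 1 A → Σ M2 λ B → Σ ℤ λ t → InV Γ 2 2 B × A ≋[mod 2 ] B ⊕ t ⊛ I
V₁⊆V₂+⟨I⟩ {A = A} Γ-sub (trA , (γ , γ∈Γ , γ≋) , _) with ≋[mod]-split {M = γ} {A = A} 2 2 γ≋
... | N , refl , N≋A =
  B , det N , (trB , (_ , ^ᴹ-closed Γ-sub γ∈Γ 2 , [I⊕2N]^2≋exp1[2] N) , exp1-≋[mod]-I 2 2 B) , A≋B⊕detN⊛I
  where
  B = N ⊕ N · N
  2∣trN : + 2 ∣ tr N
  2∣trN = ≡[mod]0⇒∣ (≡[mod]-trans {x = tr N} {y = tr A} {z = + 0} (≋[mod]⇒tr-≡[mod] {M = N} N≋A) trA)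
  trB : tr B ≡[mod 2 ] + 0
  trB = ∣⇒≡[mod]0 (subst (+ 2 ∣_) (sym (tr-⊕-square N)) (∣m∣n⇒∣m-n (∣m⇒∣m*n _ 2∣trN) (∣m⇒∣m*n (det N) ∣-refl)))
  A≋B⊕detN⊛I : A ≋[mod 2 ] B ⊕ det N ⊛ I
  A≋B⊕detN⊛I = begin
    A                          ≈⟨ N≋A ⟨
    N                          ≈⟨ ≋[mod]-⊕-multiple N N 2∣trN ⟨
    N ⊕ tr N ⊛ N               ≡⟨ cong (N ⊕_) (cayley-hamilton N) ⟨
    N ⊕ (N · N ⊕ det N ⊛ I)    ≡⟨ ⊕-assoc N (N · N) (det N ⊛ I) ⟨
    B ⊕ det N ⊛ I              ∎
    where open SetoidReasoning (≋[mod]-setoid 2)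

proposition4p3 : (p : ℕ) → Prime p → (Γ : M2 → Set) → IsCongruenceSubgroupPPowerLevel p Γ →
    ((s : ℕ) → 1 ≤ s → p ^ s ≢ 2 → (A : M2) → InV Γ p s A → InV Γ p (suc s) A)
    × (p ≡ 2 → (A : M2) → InV Γ p 1 A →
         Σ M2 λ B → Σ ℤ λ t → InV Γ p 2 B × (A ≋[mod p ] (B ⊕ (t ⊛ I))))
proposition4p3 p p-prime Γ (Γ-sub , _) =
  (λ s 1≤s p^s≢2 A → V[s]⊆V[1+s] {A = A} p-prime Γ-sub 1≤s p^s≢2) ,
  λ { refl A → V₁⊆V₂+⟨I⟩ {A = A} Γ-sub }
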